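{- For every $n\ge 1$, the number of inversion sequences of length $n$ that avoid $120$, $201$, and $1010$ and have exactly $n-1$ layers is $\binom{n+1}{3}$.
   Context: An inversion sequence of length $n$ is a word $e=e_1\cdots e_n$ of integers with $0\le e_i\le i-1$. A word $w$ contains a pattern $p=p_1\cdots p_k$ if $w$ has a subsequence $w_{\alpha_1}\cdots w_{\alpha_k}$ ($\alpha_1<\cdots<\alpha_k$) with $w_{\alpha_i}<w_{\alpha_j}$ iff $p_i<p_j$ and $w_{\alpha_i}=w_{\alpha_j}$ iff $p_i=p_j$; otherwise it avoids $p$. The layers of a word are its maximal contiguous weakly decreasing factors; the number of layers equals one plus the number of indices $i$ with $w_i<w_{i+1}$. -}

module Defs where

open import Data.Nat using (ℕ; zero; suc; _+_; _∸_; _<ᵇ_; _≡ᵇ_)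
open import Data.Bool using (Bool; true; false; _∧_; _∨_; not; if_then_else_)
open import Data.List using (List; []; _∷_; length; map; filter; concatMap; upTo; _++_)
open import Data.Bool.ListAction using (any)
open import Relation.Nullary.Decidable using (does)
open import Relation.Binary.PropositionalEquality using (_≡_; refl)
open import Data.Bool.Properties using () renaming (_≟_ to _≟ᵇ_)

Word : Set
Word = List ℕ

-- Inversion sequence: e₁ ⋯ eₙ with 0 ≤ eᵢ ≤ i - 1 (1-indexed), i.e. eᵢ < i.
isInvSeqFrom : ℕ → Word → Bool
isInvSeqFrom i [] = true
isInvSeqFrom i (x ∷ w) = (x <ᵇ suc i) ∧ isInvSeqFrom (suc i) w

isInvSeq : Word → Bool
isInvSeq = isInvSeqFrom 0

invSeqs : ℕ → List Word
invSeqs zero = []  ∷ []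
invSeqs (suc n) = concatMap (λ w → map (λ x → w ++ (x ∷ [])) (upTo (suc n))) (invSeqs n)

subseqs : ℕ → Word → List Word
subseqs zero w = [] ∷ []
subseqs (suc k) [] = []
subseqs (suc k) (x ∷ w) = map (x ∷_) (subseqs k w) ++ subseqs (suc k) w

samePair : ℕ → ℕ → ℕ → ℕ → Bool
samePair a b p q = does ((a <ᵇ b) ≟ᵇ (p <ᵇ q)) ∧ does ((a ≡ᵇ b) ≟ᵇ (p ≡ᵇ q))

-- Order-isomorphism between two words of the same length (pairwise test over
-- all index pairs i < j; together with the symmetric swap this covers all i, j).
orderIso : Word → Word → Bool
orderIso [] [] = true
orderIso (a ∷ u) (p ∷ v) = allPairs u v ∧ orderIso u v
  where
    allPairs : Word → Word → Bool
    allPairs [] [] = true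
    allPairs (b ∷ u') (q ∷ v') = samePair a b p q ∧ samePair b a q p ∧ allPairs u' v'
    allPairs _ _ = false
orderIso _ _ = false

contains : Word → Word → Bool
contains w p = any (λ s → orderIso s p) (subseqs (length p) w)

avoids : Word → Word → Bool
avoids w p = not (contains w p)

ascents : Word → ℕ
ascents [] = 0
ascents (x ∷ []) = 0
ascents (x ∷ y ∷ w) = (if x <ᵇ y then 1 else 0) + ascents (y ∷ w)

-- Number of layers (maximal weakly decreasing factors) = 1 + #ascents.
layers : Word → ℕ
layers w = suc (ascents w)

p120 p201 p1010 : Word
p120 = 1 ∷ 2 ∷ 0 ∷ []
p201 = 2 ∷ 0 ∷ 1 ∷ []
p1010 = 1 ∷ 0 ∷ 1 ∷ 0 ∷ []

goodSeqs : ℕ → List Word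
goodSeqs n = filter (λ e → avoids e p120 ∧ avoids e p201 ∧ avoids e p1010 ≟ᵇ true)
                    (filter (λ e → layers e Data.Nat.≟ (n ∸ 1)) (invSeqs n))

{-# OPTIONS --safe #-}
-- An inversion sequence of length n with n - 1 layers has exactly one non-ascent. Call it good
-- if it also avoids 120, 201 and 1010, and call n - 1 - eₙ its gap. Appending x to an inversion
-- sequence v of length n ≥ 2 gives a good sequence exactly when either v is the staircase
-- 0 1 ⋯ (n-1) and x ∈ {n-2, n-1} (a smaller x creates a 120), or v is good and x exceeds its last
-- letter. In the second case nothing new has to be avoided: every letter of a good sequence is at
-- most one more than its last letter, so x dominates v, whereas each of the three patterns ends
-- below its first letter. Hence Gₙ(φ) = Σ φ(gap e) over the good e of length n satisfies
-- Gₙ₊₁(φ) = Gₙ(Ψφ) + φ(1) + φ(2) with (Ψφ)(s) = φ(0) + ⋯ + φ(s), which solves to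
-- Gₖ₊₂(φ) = C(k+2,3) φ(0) + (1 + C(k+1,2)) φ(1) + k φ(2); the count is Gₖ₊₂(1) = C(k+3,3).
module Submission where

open import Defs
open import Data.Bool using (Bool; true; false; T; _∧_; if_then_else_)
open import Data.Bool.ListAction using (and)
open import Data.Bool.Properties using (T-∧) renaming (_≟_ to _≟ᵇ_)
open import Data.List
  using (List; []; _∷_; _++_; _∷ʳ_; [_]; length; map; filter; concatMap; reverse;
         applyUpTo; applyDownFrom; upTo)
open import Data.List.Membership.Propositional using (_∈_; find; lose)
open import Data.List.Membership.Propositional.Properties
  using (∈-++⁺ˡ; ∈-++⁺ʳ; ∈-++⁻; ∈-map⁺; ∈-map⁻; ∈-concatMap⁻; ∈-applyUpTo⁺; ∈-upTo⁻)
open import Data.List.Properties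
  using (≡-dec; map-++; map-∘; map-cong; map-cong-local; map-upTo; length-++; applyUpTo-∷ʳ;
         upTo-∷ʳ; ∷ʳ-injective; reverse-applyUpTo)
open import Data.List.Relation.Binary.Permutation.Propositional.Properties using (↭-reverse)
open import Data.List.Relation.Binary.Sublist.Propositional
  using (_⊆_; []; _∷_; minimum; from∈) renaming (_∷ʳ_ to skip)
open import Data.List.Relation.Binary.Sublist.Propositional.Properties
  using (All-resp-⊆; ++⁺; ++⁺ʳ)
open import Data.List.Relation.Unary.All as All using (All; []; _∷_)
open import Data.List.Relation.Unary.All.Properties using (all-upTo) renaming (++⁺ to All-++⁺)
open import Data.List.Relation.Unary.AllPairs using (AllPairs; []; _∷_)
import Data.List.Relation.Unary.AllPairs.Properties as AllPairs
open import Data.List.Relation.Unary.Any using (here)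
open import Data.List.Relation.Unary.Any.Properties using (any⁺; any⁻)
open import Data.Nat
  using (ℕ; zero; suc; _+_; _*_; _∸_; _≤_; _<_; _≮_; _≥_; z≤n; s≤s; z<s; s<s; _<ᵇ_;
         _≟_; _<?_; _≤?_)
open import Data.Nat.Combinatorics using (_C_; nC1≡n; nCk+nC[k+1]≡[n+1]C[k+1])
open import Data.Nat.ListAction using (sum)
open import Data.Nat.ListAction.Properties using (sum-++; sum-↭)
open import Data.Nat.Properties
open import Data.Nat.Solver using (module +-*-Solver)
open import Algebra.Properties.CommutativeSemigroup +-commutativeSemigroup using (interchange)
open import Data.Product using (∃-syntax; ∃₂; _×_; _,_; proj₁; proj₂)
open import Data.Sum using (_⊎_; inj₁; inj₂; [_,_]′)
open import Function using (_∘_; id; Equivalence)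
open import Relation.Binary.Definitions using (DecidableEquality)
open import Relation.Binary.PropositionalEquality
  using (_≡_; _≢_; refl; sym; trans; cong; cong₂; subst; subst₂; module ≡-Reasoning)
open import Relation.Nullary using (¬_; Dec; yes; no; does; ¬?; contradiction)
open import Relation.Nullary.Decidable using (map′; _×-dec_; T?; dec-true; dec-false)
open import Relation.Nullary.Reflects using (ofʸ; ofⁿ)
open import Relation.Unary using (Decidable)
open ≡-Reasoning

private
  variable
    A B : Set

sum-map-+ : (f g : A → ℕ) (xs : List A) →
            sum (map (λ x → f x + g x) xs) ≡ sum (map f xs) + sum (map g xs)
sum-map-+ f g []       = refl
sum-map-+ f g (x ∷ xs) =
  trans (cong (f x + g x +_) (sum-map-+ f g xs)) (interchange (f x) (g x) _ _)

sum-map-concatMap : (f : B → ℕ) (g : A → List B) (xs : List A) →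
                    sum (map f (concatMap g xs)) ≡ sum (map (λ x → sum (map f (g x))) xs)
sum-map-concatMap f g []       = refl
sum-map-concatMap f g (x ∷ xs) = begin
  sum (map f (g x ++ concatMap g xs))                         ≡⟨ cong sum (map-++ f (g x) _) ⟩
  sum (map f (g x) ++ map f (concatMap g xs))                 ≡⟨ sum-++ (map f (g x)) _ ⟩
  sum (map f (g x)) + sum (map f (concatMap g xs))            ≡⟨ cong (sum (map f (g x)) +_)
                                                                      (sum-map-concatMap f g xs) ⟩
  sum (map f (g x)) + sum (map (λ x → sum (map f (g x))) xs) ∎

sum-map-cong-∈ : {f g : A → ℕ} {xs : List A} → (∀ {x} → x ∈ xs → f x ≡ g x) →
                 sum (map f xs) ≡ sum (map g xs)
sum-map-cong-∈ f≗g = cong sum (map-cong-local (All.tabulate f≗g))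

applyUpTo-cong : (f g : ℕ → A) (n : ℕ) → (∀ {i} → i < n → f i ≡ g i) →
                 applyUpTo f n ≡ applyUpTo g n
applyUpTo-cong f g zero    f≗g = refl
applyUpTo-cong f g (suc n) f≗g =
  cong₂ _∷_ (f≗g z<s) (applyUpTo-cong (f ∘ suc) (g ∘ suc) n (f≗g ∘ s<s))

applyUpTo-reverse : (f : ℕ → A) (n : ℕ) → applyUpTo (λ i → f (n ∸ suc i)) n ≡ applyDownFrom f n
applyUpTo-reverse f zero    = refl
applyUpTo-reverse f (suc n) = cong (f n ∷_) (applyUpTo-reverse f n)

sum-applyUpTo-zero : (f : ℕ → ℕ) (n : ℕ) → (∀ {i} → i < n → f i ≡ 0) → sum (applyUpTo f n) ≡ 0
sum-applyUpTo-zero f zero    f≡0 = refl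
sum-applyUpTo-zero f (suc n) f≡0 =
  cong₂ _+_ (f≡0 z<s) (sum-applyUpTo-zero (f ∘ suc) n (f≡0 ∘ s<s))

sum-applyUpTo-suc : (f : ℕ → ℕ) (n : ℕ) → sum (applyUpTo f (suc n)) ≡ sum (applyUpTo f n) + f n
sum-applyUpTo-suc f n = begin
  sum (applyUpTo f (suc n))       ≡⟨ cong sum (applyUpTo-∷ʳ f n) ⟨
  sum (applyUpTo f n ∷ʳ f n)      ≡⟨ sum-++ (applyUpTo f n) [ f n ] ⟩
  sum (applyUpTo f n) + (f n + 0) ≡⟨ cong (sum (applyUpTo f n) +_) (+-identityʳ (f n)) ⟩
  sum (applyUpTo f n) + f n       ∎

sum-applyUpTo-reverse : (f : ℕ → ℕ) (n : ℕ) →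
                        sum (applyUpTo (λ i → f (n ∸ suc i)) n) ≡ sum (applyUpTo f n)
sum-applyUpTo-reverse f n = begin
  sum (applyUpTo (λ i → f (n ∸ suc i)) n) ≡⟨ cong sum (applyUpTo-reverse f n) ⟩
  sum (applyDownFrom f n)                 ≡⟨ cong sum (reverse-applyUpTo f n) ⟨
  sum (reverse (applyUpTo f n))           ≡⟨ sum-↭ (↭-reverse (applyUpTo f n)) ⟩
  sum (applyUpTo f n)                     ∎

sum-applyUpTo-above : (f : ℕ → ℕ) (l n : ℕ) →
  sum (applyUpTo (λ x → if l <ᵇ x then f (n ∸ x) else 0) (suc n)) ≡ sum (applyUpTo f (n ∸ l))
sum-applyUpTo-above f zero    n       = sum-applyUpTo-reverse f n
sum-applyUpTo-above f (suc l) zero    = refl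
sum-applyUpTo-above f (suc l) (suc n) = sum-applyUpTo-above f l n

⊆-∷ʳ⁻ : {s w : List A} {x : A} → s ⊆ w ∷ʳ x → s ⊆ w ⊎ ∃[ t ] (t ⊆ w × s ≡ t ∷ʳ x)
⊆-∷ʳ⁻ {w = []}    (skip _ []) = inj₁ []
⊆-∷ʳ⁻ {w = []}    (refl ∷ []) = inj₂ ([] , [] , refl)
⊆-∷ʳ⁻ {w = y ∷ w} (skip .y p) with ⊆-∷ʳ⁻ p
... | inj₁ q           = inj₁ (skip y q)
... | inj₂ (t , q , e) = inj₂ (t , skip y q , e)
⊆-∷ʳ⁻ {w = y ∷ w} (refl ∷ p) with ⊆-∷ʳ⁻ p
... | inj₁ q              = inj₁ (refl ∷ q)
... | inj₂ (t , q , refl) = inj₂ (y ∷ t , refl ∷ q , refl)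

AllPairs-resp-⊆ : {R : A → A → Set} {s w : List A} → s ⊆ w → AllPairs R w → AllPairs R s
AllPairs-resp-⊆ []         []       = []
AllPairs-resp-⊆ (skip _ p) (_ ∷ rs) = AllPairs-resp-⊆ p rs
AllPairs-resp-⊆ (refl ∷ p) (r ∷ rs) = All-resp-⊆ p r ∷ AllPairs-resp-⊆ p rs

pair⊆applyUpTo : (f : ℕ → A) {i j n : ℕ} → i < j → j < n → f i ∷ f j ∷ [] ⊆ applyUpTo f n
pair⊆applyUpTo f {zero}  {suc j} {suc n} _         (s<s j<n) =
  refl ∷ from∈ (∈-applyUpTo⁺ (f ∘ suc) j<n)
pair⊆applyUpTo f {suc i} {suc j} {suc n} (s<s i<j) (s<s j<n) =
  skip (f 0) (pair⊆applyUpTo (f ∘ suc) i<j j<n)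

subseqs⇒⊆ : (k : ℕ) (w : Word) {s : Word} → s ∈ subseqs k w → s ⊆ w
subseqs⇒⊆ zero    w       (here refl) = minimum w
subseqs⇒⊆ (suc k) (y ∷ w) s∈ with ∈-++⁻ (map (y ∷_) (subseqs k w)) s∈
... | inj₁ s∈kept with ∈-map⁻ (y ∷_) s∈kept
...   | t , t∈ , refl = refl ∷ subseqs⇒⊆ k w t∈
subseqs⇒⊆ (suc k) (y ∷ w) s∈ | inj₂ s∈skipped = skip y (subseqs⇒⊆ (suc k) w s∈skipped)

⊆⇒subseqs : {s w : Word} → s ⊆ w → s ∈ subseqs (length s) w
⊆⇒subseqs []                 = here refl
⊆⇒subseqs {[]}    (skip y p) = here refl
⊆⇒subseqs {x ∷ s} (skip y p) = ∈-++⁺ʳ (map (y ∷_) (subseqs (length s) _)) (⊆⇒subseqs p)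
⊆⇒subseqs (refl ∷ p)         = ∈-++⁺ˡ (∈-map⁺ (_ ∷_) (⊆⇒subseqs p))

orderIso-length : (s p : Word) → T (orderIso s p) → length s ≡ length p
orderIso-length []      []      _   = refl
orderIso-length (a ∷ s) (q ∷ p) iso =
  cong suc (orderIso-length s p (proj₂ (Equivalence.to T-∧ iso)))

Occurs : Word → Word → Set
Occurs p w = ∃[ s ] (s ⊆ w × T (orderIso s p))

contains⇒Occurs : (w p : Word) → T (contains w p) → Occurs p w
contains⇒Occurs w p c with find (any⁻ (λ s → orderIso s p) (subseqs (length p) w) c)
... | s , s∈ , iso = s , subseqs⇒⊆ (length p) w s∈ , iso

Occurs⇒contains : {w p : Word} → Occurs p w → T (contains w p)
Occurs⇒contains {w} {p} (s , s⊆w , iso) = any⁺ (λ s → orderIso s p) (lose s∈ iso)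
  where
  s∈ : s ∈ subseqs (length p) w
  s∈ = subst (λ k → s ∈ subseqs k w) (orderIso-length s p iso) (⊆⇒subseqs s⊆w)

avoids? : (w p : Word) → Dec (¬ Occurs p w)
avoids? w p = map′ (λ ¬c → ¬c ∘ Occurs⇒contains) (λ ¬o → ¬o ∘ contains⇒Occurs w p)
                   (¬? (T? (contains w p)))

OccursAtEnd : Word → Word → ℕ → Set
OccursAtEnd p w x = ∃[ s ] (s ⊆ w × T (orderIso (s ∷ʳ x) p))

Occurs-∷ʳ⁻ : {p w : Word} {x : ℕ} → Occurs p (w ∷ʳ x) → Occurs p w ⊎ OccursAtEnd p w x
Occurs-∷ʳ⁻ (s , s⊆ , iso) with ⊆-∷ʳ⁻ s⊆
... | inj₁ s⊆w              = inj₁ (s , s⊆w , iso)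
... | inj₂ (t , t⊆w , refl) = inj₂ (t , t⊆w , iso)

¬Occurs-∷ʳ : {p w : Word} {x : ℕ} → ¬ Occurs p w → ¬ OccursAtEnd p w x → ¬ Occurs p (w ∷ʳ x)
¬Occurs-∷ʳ ¬o ¬e = [ ¬o , ¬e ]′ ∘ Occurs-∷ʳ⁻

¬Occurs-∷ʳ⁻ : {p w : Word} {x : ℕ} → ¬ Occurs p (w ∷ʳ x) → ¬ Occurs p w
¬Occurs-∷ʳ⁻ {x = x} ¬o (s , s⊆w , iso) = ¬o (s , ++⁺ʳ [ x ] s⊆w , iso)

¬Occurs-[] : {q : ℕ} {p : Word} → ¬ Occurs (q ∷ p) []
¬Occurs-[] (_ , [] , ())

≟ᵇ-sound : {x y : Bool} → T (does (x ≟ᵇ y)) → x ≡ y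
≟ᵇ-sound {false} {false} _ = refl
≟ᵇ-sound {true}  {true}  _ = refl

samePair-< : (a b q r : ℕ) → T (samePair a b q r) → q < r → a < b
samePair-< a b q r same q<r =
  <ᵇ⇒< a b (subst T (sym (≟ᵇ-sound (proj₁ (Equivalence.to T-∧ same)))) (<⇒<ᵇ q<r))

-- Listing the conjuncts explicitly lets Agda split a conjunction whose first conjunct is stuck.
T-and∧⁻ : (bs : List Bool) {b : Bool} → T (and bs ∧ b) → All T bs
T-and∧⁻ []           _ = []
T-and∧⁻ (true ∷ bs)  t = _ ∷ T-and∧⁻ bs t
T-and∧⁻ (false ∷ bs) ()

occursAtEnd-120 : (s : Word) {x : ℕ} → T (orderIso (s ∷ʳ x) p120) →
                  ∃₂ λ a b → s ≡ a ∷ b ∷ [] × x < a × a < b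
occursAtEnd-120 []                          ()
occursAtEnd-120 (a ∷ b ∷ [])            {x} iso
  with T-and∧⁻ (samePair a b 1 2 ∷ samePair b a 2 1 ∷ samePair a x 1 0 ∷ samePair x a 0 1 ∷ []) iso
... | ab ∷ _ ∷ _ ∷ xa ∷ [] = a , b , refl , samePair-< x a 0 1 xa z<s , samePair-< a b 1 2 ab (s<s z<s)
occursAtEnd-120 s@(_ ∷ [])              {x} iso = contradiction (orderIso-length (s ∷ʳ x) p120 iso) λ ()
occursAtEnd-120 s@(_ ∷ _ ∷ _ ∷ [])      {x} iso = contradiction (orderIso-length (s ∷ʳ x) p120 iso) λ ()
occursAtEnd-120 s@(_ ∷ _ ∷ _ ∷ _ ∷ _)   {x} iso = contradiction (orderIso-length (s ∷ʳ x) p120 iso) λ ()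

occursAtEnd-201 : (s : Word) {x : ℕ} → T (orderIso (s ∷ʳ x) p201) →
                  ∃₂ λ a b → s ≡ a ∷ b ∷ [] × x < a × b < a
occursAtEnd-201 []                          ()
occursAtEnd-201 (a ∷ b ∷ [])            {x} iso
  with T-and∧⁻ (samePair a b 2 0 ∷ samePair b a 0 2 ∷ samePair a x 2 1 ∷ samePair x a 1 2 ∷ []) iso
... | _ ∷ ba ∷ _ ∷ xa ∷ [] = a , b , refl , samePair-< x a 1 2 xa (s<s z<s) , samePair-< b a 0 2 ba z<s
occursAtEnd-201 s@(_ ∷ [])              {x} iso = contradiction (orderIso-length (s ∷ʳ x) p201 iso) λ ()
occursAtEnd-201 s@(_ ∷ _ ∷ _ ∷ [])      {x} iso = contradiction (orderIso-length (s ∷ʳ x) p201 iso) λ ()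
occursAtEnd-201 s@(_ ∷ _ ∷ _ ∷ _ ∷ _)   {x} iso = contradiction (orderIso-length (s ∷ʳ x) p201 iso) λ ()

occursAtEnd-1010 : (s : Word) {x : ℕ} → T (orderIso (s ∷ʳ x) p1010) →
                   ∃₂ λ a b → ∃[ c ] (s ≡ a ∷ b ∷ c ∷ [] × x < a × b < a)
occursAtEnd-1010 []                         ()
occursAtEnd-1010 (a ∷ b ∷ c ∷ [])       {x} iso
  with T-and∧⁻ (samePair a b 1 0 ∷ samePair b a 0 1 ∷ samePair a c 1 1 ∷ samePair c a 1 1 ∷
                samePair a x 1 0 ∷ samePair x a 0 1 ∷ []) iso
... | _ ∷ ba ∷ _ ∷ _ ∷ _ ∷ xa ∷ [] =
  a , b , c , refl , samePair-< x a 0 1 xa z<s , samePair-< b a 0 1 ba z<s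
occursAtEnd-1010 s@(_ ∷ [])             {x} iso = contradiction (orderIso-length (s ∷ʳ x) p1010 iso) λ ()
occursAtEnd-1010 s@(_ ∷ _ ∷ [])         {x} iso = contradiction (orderIso-length (s ∷ʳ x) p1010 iso) λ ()
occursAtEnd-1010 s@(_ ∷ _ ∷ _ ∷ _ ∷ []) {x} iso = contradiction (orderIso-length (s ∷ʳ x) p1010 iso) λ ()
occursAtEnd-1010 s@(_ ∷ _ ∷ _ ∷ _ ∷ _ ∷ _) {x} iso =
  contradiction (orderIso-length (s ∷ʳ x) p1010 iso) λ ()

occurs120-shifted : (x : ℕ) → T (orderIso (suc x ∷ suc (suc x) ∷ x ∷ []) p120)
occurs120-shifted zero    = _
occurs120-shifted (suc x) = occurs120-shifted x

AvoidsAll : Word → Set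
AvoidsAll w = ¬ Occurs p120 w × ¬ Occurs p201 w × ¬ Occurs p1010 w

AvoidsAllAtEnd : Word → ℕ → Set
AvoidsAllAtEnd w x = ¬ OccursAtEnd p120 w x × ¬ OccursAtEnd p201 w x × ¬ OccursAtEnd p1010 w x

AvoidsAll-∷ʳ : {w : Word} {x : ℕ} → AvoidsAll w → AvoidsAllAtEnd w x → AvoidsAll (w ∷ʳ x)
AvoidsAll-∷ʳ (¬120 , ¬201 , ¬1010) (¬end120 , ¬end201 , ¬end1010) =
  ¬Occurs-∷ʳ ¬120 ¬end120 , ¬Occurs-∷ʳ ¬201 ¬end201 , ¬Occurs-∷ʳ ¬1010 ¬end1010

AvoidsAll-∷ʳ⁻ : {w : Word} {x : ℕ} → AvoidsAll (w ∷ʳ x) → AvoidsAll w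
AvoidsAll-∷ʳ⁻ (¬120 , ¬201 , ¬1010) = ¬Occurs-∷ʳ⁻ ¬120 , ¬Occurs-∷ʳ⁻ ¬201 , ¬Occurs-∷ʳ⁻ ¬1010

AvoidsAll-∷ʳ-max : {w : Word} {x : ℕ} → All (_≤ x) w → AvoidsAll w → AvoidsAll (w ∷ʳ x)
AvoidsAll-∷ʳ-max {w} {x} w≤x avoid = AvoidsAll-∷ʳ avoid (end120 , end201 , end1010)
  where
  firstAbove : {a : ℕ} {t : Word} → a ∷ t ⊆ w → ¬ x < a
  firstAbove a∷t⊆w with All-resp-⊆ a∷t⊆w w≤x
  ... | a≤x ∷ _ = ≤⇒≯ a≤x
  end120 : ¬ OccursAtEnd p120 w x
  end120 (s , s⊆w , iso) with occursAtEnd-120 s iso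
  ... | _ , _ , refl , x<a , _ = firstAbove s⊆w x<a
  end201 : ¬ OccursAtEnd p201 w x
  end201 (s , s⊆w , iso) with occursAtEnd-201 s iso
  ... | _ , _ , refl , x<a , _ = firstAbove s⊆w x<a
  end1010 : ¬ OccursAtEnd p1010 w x
  end1010 (s , s⊆w , iso) with occursAtEnd-1010 s iso
  ... | _ , _ , _ , refl , x<a , _ = firstAbove s⊆w x<a

upTo-increasing : {a b n : ℕ} {t : Word} → a ∷ b ∷ t ⊆ upTo n → a < b
upTo-increasing {n = n} s⊆ with AllPairs-resp-⊆ s⊆ (AllPairs.applyUpTo⁺₁ id n (λ i<j _ → i<j))
... | (a<b ∷ _) ∷ _ = a<b

upTo-AvoidsAllAtEnd : (n : ℕ) {x : ℕ} → n ≤ 2 + x → AvoidsAllAtEnd (upTo n) x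
upTo-AvoidsAllAtEnd n {x} n≤2+x = end120 , end201 , end1010
  where
  end120 : ¬ OccursAtEnd p120 (upTo n) x
  end120 (s , s⊆ , iso) with occursAtEnd-120 s iso
  ... | a , b , refl , x<a , a<b with All-resp-⊆ s⊆ (all-upTo n)
  ...   | _ ∷ b<n ∷ [] =
    <-irrefl refl (≤-trans (s≤s (s≤s x<a)) (≤-trans (s≤s a<b) (≤-trans b<n n≤2+x)))
  end201 : ¬ OccursAtEnd p201 (upTo n) x
  end201 (s , s⊆ , iso) with occursAtEnd-201 s iso
  ... | _ , _ , refl , _ , b<a = <-asym b<a (upTo-increasing s⊆)
  end1010 : ¬ OccursAtEnd p1010 (upTo n) x
  end1010 (s , s⊆ , iso) with occursAtEnd-1010 s iso
  ... | _ , _ , _ , refl , _ , b<a = <-asym b<a (upTo-increasing s⊆)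

AvoidsAll-upTo : (n : ℕ) → AvoidsAll (upTo n)
AvoidsAll-upTo zero    = ¬Occurs-[] , ¬Occurs-[] , ¬Occurs-[]
AvoidsAll-upTo (suc n) =
  subst AvoidsAll (upTo-∷ʳ n) (AvoidsAll-∷ʳ (AvoidsAll-upTo n) (upTo-AvoidsAllAtEnd n (m≤n+m n 2)))

upTo-∷ʳ-Occurs120 : {n x : ℕ} → 2 + x < n → Occurs p120 (upTo n ∷ʳ x)
upTo-∷ʳ-Occurs120 {n} {x} 2+x<n =
  (suc x ∷ suc (suc x) ∷ []) ∷ʳ x ,
  ++⁺ (pair⊆applyUpTo id (n<1+n (suc x)) 2+x<n) (refl ∷ []) ,
  occurs120-shifted x

lastLetter : Word → ℕ
lastLetter []          = 0
lastLetter (x ∷ [])    = x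
lastLetter (_ ∷ y ∷ w) = lastLetter (y ∷ w)

lastLetter-∷ʳ : (w : Word) (x : ℕ) → lastLetter (w ∷ʳ x) ≡ x
lastLetter-∷ʳ []          x = refl
lastLetter-∷ʳ (_ ∷ [])    x = refl
lastLetter-∷ʳ (_ ∷ y ∷ w) x = lastLetter-∷ʳ (y ∷ w) x

lastLetter-upTo : (n : ℕ) → lastLetter (upTo (suc n)) ≡ n
lastLetter-upTo n = trans (cong lastLetter (sym (upTo-∷ʳ n))) (lastLetter-∷ʳ (upTo n) n)

ascents-∷ʳ-< : (y : ℕ) (v : Word) {x : ℕ} → lastLetter (y ∷ v) < x →
               ascents ((y ∷ v) ∷ʳ x) ≡ suc (ascents (y ∷ v))
ascents-∷ʳ-< y []      {x} y<x with y <ᵇ x | <ᵇ-reflects-< y x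
... | true  | _       = refl
... | false | ofⁿ y≮x = contradiction y<x y≮x
ascents-∷ʳ-< y (z ∷ v) {x} l<x =
  trans (cong ((if y <ᵇ z then 1 else 0) +_) (ascents-∷ʳ-< z v l<x)) (+-suc _ _)

ascents-∷ʳ-≮ : (y : ℕ) (v : Word) {x : ℕ} → lastLetter (y ∷ v) ≮ x →
               ascents ((y ∷ v) ∷ʳ x) ≡ ascents (y ∷ v)
ascents-∷ʳ-≮ y []      {x} y≮x with y <ᵇ x | <ᵇ-reflects-< y x
... | true  | ofʸ y<x = contradiction y<x y≮x
... | false | _       = refl
ascents-∷ʳ-≮ y (z ∷ v) {x} l≮x = cong ((if y <ᵇ z then 1 else 0) +_) (ascents-∷ʳ-≮ z v l≮x)

ascents-≤ : (y : ℕ) (v : Word) → ascents (y ∷ v) ≤ length v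
ascents-≤ y []      = z≤n
ascents-≤ y (z ∷ v) with y <ᵇ z
... | true  = s≤s (ascents-≤ z v)
... | false = m≤n⇒m≤1+n (ascents-≤ z v)

ascents-upTo : (n : ℕ) → ascents (upTo (suc n)) ≡ n
ascents-upTo zero    = refl
ascents-upTo (suc n) = begin
  ascents (upTo (suc (suc n)))     ≡⟨ cong ascents (upTo-∷ʳ (suc n)) ⟨
  ascents (upTo (suc n) ∷ʳ suc n)  ≡⟨ ascents-∷ʳ-< 0 (applyUpTo suc n)
                                                   (s≤s (≤-reflexive (lastLetter-upTo n))) ⟩
  suc (ascents (upTo (suc n)))     ≡⟨ cong suc (ascents-upTo n) ⟩
  suc n                            ∎

invSeqs-∷ʳ⁻ : (n : ℕ) {e : Word} → e ∈ invSeqs (suc n) →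
              ∃₂ λ v x → v ∈ invSeqs n × x < suc n × e ≡ v ∷ʳ x
invSeqs-∷ʳ⁻ n e∈ with find (∈-concatMap⁻ (λ v → map (v ∷ʳ_) (upTo (suc n))) e∈)
... | v , v∈ , e∈extensions with ∈-map⁻ (v ∷ʳ_) e∈extensions
...   | x , x∈ , refl = v , x , v∈ , ∈-upTo⁻ x∈ , refl

invSeqs-length : (n : ℕ) {e : Word} → e ∈ invSeqs n → length e ≡ n
invSeqs-length zero    (here refl) = refl
invSeqs-length (suc n) e∈ with invSeqs-∷ʳ⁻ n e∈
... | v , x , v∈ , _ , refl =
  trans (length-++ v) (trans (+-comm (length v) 1) (cong suc (invSeqs-length n v∈)))

staircase-unique : (m : ℕ) {e : Word} → e ∈ invSeqs (suc m) → ascents e ≡ m → e ≡ upTo (suc m)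
staircase-unique m e∈ asc with invSeqs-∷ʳ⁻ m e∈
staircase-unique zero    _ _   | .[] , zero  , here refl , _      , refl = refl
staircase-unique zero    _ _   | .[] , suc _ , here refl , s≤s () , _
staircase-unique (suc m) _ _   | []    , _ , v∈ , _ , _ =
  contradiction (invSeqs-length (suc m) v∈) λ ()
staircase-unique (suc m) _ asc | y ∷ v , x , v∈ , x<2+m , refl with lastLetter (y ∷ v) <? x
... | yes l<x = begin
  (y ∷ v) ∷ʳ x           ≡⟨ cong₂ _∷ʳ_ v≡upTo x≡1+m ⟩
  upTo (suc m) ∷ʳ suc m  ≡⟨ upTo-∷ʳ (suc m) ⟩
  upTo (suc (suc m))     ∎
  where
  v≡upTo : y ∷ v ≡ upTo (suc m)
  v≡upTo = staircase-unique m v∈ (suc-injective (trans (sym (ascents-∷ʳ-< y v l<x)) asc))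
  x≡1+m : x ≡ suc m
  x≡1+m = ≤-antisym (≤-pred x<2+m)
                    (subst (_< x) (trans (cong lastLetter v≡upTo) (lastLetter-upTo m)) l<x)
... | no l≮x =
  contradiction (subst₂ _≤_ (trans (sym (ascents-∷ʳ-≮ y v l≮x)) asc) |v|≡m (ascents-≤ y v)) 1+n≰n
  where
  |v|≡m : length v ≡ m
  |v|≡m = suc-injective (invSeqs-length (suc m) v∈)

sum-invSeqs-suc : (f : Word → ℕ) (n : ℕ) →
  sum (map f (invSeqs (suc n))) ≡
  sum (map (λ v → sum (applyUpTo (λ x → f (v ∷ʳ x)) (suc n))) (invSeqs n))
sum-invSeqs-suc f n =
  trans (sum-map-concatMap f (λ v → map (v ∷ʳ_) (upTo (suc n))) (invSeqs n))
        (cong sum (map-cong (λ v → cong sum (trans (sym (map-∘ (upTo (suc n))))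
                                                   (map-upTo _ (suc n))))
                            (invSeqs n)))

infix 4 _≟ʷ_
_≟ʷ_ : DecidableEquality Word
_≟ʷ_ = ≡-dec _≟_

staircaseWeight : ℕ → ℕ → Word → ℕ
staircaseWeight n c e = if does (e ≟ʷ upTo n) then c else 0

staircaseWeight-upTo : (n c : ℕ) → staircaseWeight n c (upTo n) ≡ c
staircaseWeight-upTo n c = cong (λ b → if b then c else 0) (dec-true (upTo n ≟ʷ upTo n) refl)

staircaseWeight-≢ : (n c : ℕ) (e : Word) → e ≢ upTo n → staircaseWeight n c e ≡ 0
staircaseWeight-≢ n c e e≢upTo = cong (λ b → if b then c else 0) (dec-false (e ≟ʷ upTo n) e≢upTo)

sum-staircaseWeight-∷ʳ : (n c : ℕ) (v : Word) →
  sum (applyUpTo (λ x → staircaseWeight (suc n) c (v ∷ʳ x)) (suc n)) ≡ staircaseWeight n c v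
sum-staircaseWeight-∷ʳ n c v with v ≟ʷ upTo n
... | yes refl = begin
  sum (applyUpTo s (suc n))  ≡⟨ sum-applyUpTo-suc s n ⟩
  sum (applyUpTo s n) + s n  ≡⟨ cong₂ _+_ (sum-applyUpTo-zero s n below) top ⟩
  c                          ∎
  where
  s : ℕ → ℕ
  s x = staircaseWeight (suc n) c (upTo n ∷ʳ x)
  below : {x : ℕ} → x < n → s x ≡ 0
  below {x} x<n = staircaseWeight-≢ (suc n) c (upTo n ∷ʳ x)
    (λ e → <⇒≢ x<n (proj₂ (∷ʳ-injective _ _ (trans e (sym (upTo-∷ʳ n))))))
  top : s n ≡ c
  top = trans (cong (staircaseWeight (suc n) c) (upTo-∷ʳ n)) (staircaseWeight-upTo (suc n) c)
... | no v≢upTo = sum-applyUpTo-zero _ (suc n) λ {x} _ →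
  staircaseWeight-≢ (suc n) c (v ∷ʳ x)
    (λ e → v≢upTo (proj₁ (∷ʳ-injective _ _ (trans e (sym (upTo-∷ʳ n))))))

sum-staircaseWeight-invSeqs : (n c : ℕ) → sum (map (staircaseWeight n c) (invSeqs n)) ≡ c
sum-staircaseWeight-invSeqs zero    c = +-identityʳ c
sum-staircaseWeight-invSeqs (suc n) c = begin
  sum (map (staircaseWeight (suc n) c) (invSeqs (suc n)))
    ≡⟨ sum-invSeqs-suc (staircaseWeight (suc n) c) n ⟩
  sum (map (λ v → sum (applyUpTo (λ x → staircaseWeight (suc n) c (v ∷ʳ x)) (suc n))) (invSeqs n))
    ≡⟨ cong sum (map-cong (sum-staircaseWeight-∷ʳ n c) (invSeqs n)) ⟩
  sum (map (staircaseWeight n c) (invSeqs n))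
    ≡⟨ sum-staircaseWeight-invSeqs n c ⟩
  c ∎

Good : ℕ → Word → Set
Good n e = layers e ≡ n ∸ 1 × AvoidsAll e

good? : (n : ℕ) (e : Word) → Dec (Good n e)
good? n e = layers e ≟ n ∸ 1 ×-dec avoids? e p120 ×-dec avoids? e p201 ×-dec avoids? e p1010

upTo-¬Good : (n : ℕ) → ¬ Good (suc n) (upTo (suc n))
upTo-¬Good n (layers≡n , _) = 1+n≢n (trans (cong suc (sym (ascents-upTo n))) layers≡n)

Good-upTo-∷ʳ⁻ : {n x : ℕ} → Good (suc n) (upTo n ∷ʳ x) → n ≤ 2 + x
Good-upTo-∷ʳ⁻ {n} {x} (_ , ¬120 , _) with n ≤? 2 + x
... | yes n≤2+x = n≤2+x
... | no  n≰2+x = contradiction (upTo-∷ʳ-Occurs120 (≰⇒> n≰2+x)) ¬120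

Good-upTo-∷ʳ : {k x : ℕ} → k ≤ x → x ≤ suc k → Good (3 + k) (upTo (2 + k) ∷ʳ x)
Good-upTo-∷ʳ {k} {x} k≤x x≤1+k = cong suc ascents≡ , avoid
  where
  l≮x : lastLetter (upTo (2 + k)) ≮ x
  l≮x = subst (_≮ x) (sym (lastLetter-upTo (suc k))) (≤⇒≯ x≤1+k)
  ascents≡ : ascents (upTo (2 + k) ∷ʳ x) ≡ suc k
  ascents≡ = trans (ascents-∷ʳ-≮ 0 (applyUpTo suc (suc k)) l≮x) (ascents-upTo (suc k))
  avoid : AvoidsAll (upTo (2 + k) ∷ʳ x)
  avoid = AvoidsAll-∷ʳ (AvoidsAll-upTo (2 + k)) (upTo-AvoidsAllAtEnd (2 + k) (s≤s (s≤s k≤x)))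

Good-∷ʳ⁻ : (n : ℕ) {v : Word} {x : ℕ} → v ∈ invSeqs n → v ≢ upTo n →
           Good (suc n) (v ∷ʳ x) → Good n v × lastLetter v < x
Good-∷ʳ⁻ zero    (here refl) v≢upTo _ = contradiction refl v≢upTo
Good-∷ʳ⁻ (suc m) {[]} v∈ _ _ = contradiction (invSeqs-length (suc m) v∈) λ ()
Good-∷ʳ⁻ (suc m) {y ∷ v} {x} v∈ v≢upTo (layers≡ , avoid) with lastLetter (y ∷ v) <? x
... | yes l<x =
  (suc-injective (trans (cong suc (sym (ascents-∷ʳ-< y v l<x))) layers≡) , AvoidsAll-∷ʳ⁻ avoid) , l<x
... | no  l≮x = contradiction (staircase-unique m v∈ ascents≡) v≢upTo
  where
  ascents≡ : ascents (y ∷ v) ≡ m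
  ascents≡ = suc-injective (trans (cong suc (sym (ascents-∷ʳ-≮ y v l≮x))) layers≡)

Good-bounded : (n : ℕ) {e : Word} → e ∈ invSeqs n → Good n e → All (_≤ suc (lastLetter e)) e
Good-bounded zero    (here refl) _ = []
Good-bounded (suc n) e∈ good with invSeqs-∷ʳ⁻ n e∈
... | v , x , v∈ , _ , refl =
  subst (λ l → All (_≤ suc l) (v ∷ʳ x)) (sym (lastLetter-∷ʳ v x)) (All-++⁺ v≤1+x (n≤1+n x ∷ []))
  where
  v≤1+x : All (_≤ suc x) v
  v≤1+x with v ≟ʷ upTo n
  ... | yes refl = All.map (λ i<n → ≤-pred (≤-trans i<n (Good-upTo-∷ʳ⁻ good))) (all-upTo n)
  ... | no  v≢upTo with Good-∷ʳ⁻ n v∈ v≢upTo good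
  ...   | good-v , l<x =
    All.map (λ i≤ → ≤-trans i≤ (≤-trans l<x (n≤1+n x))) (Good-bounded n v∈ good-v)

Good-∷ʳ : (n : ℕ) {v : Word} {x : ℕ} → v ∈ invSeqs n → Good n v → lastLetter v < x →
          Good (suc n) (v ∷ʳ x)
Good-∷ʳ zero    (here refl) (() , _)
Good-∷ʳ (suc n) {[]} v∈ _ _ = contradiction (invSeqs-length (suc n) v∈) λ ()
Good-∷ʳ (suc n) {y ∷ v} {x} v∈ good@(layers≡ , avoid) l<x =
  cong suc (trans (ascents-∷ʳ-< y v l<x) layers≡) ,
  AvoidsAll-∷ʳ-max (All.map (λ i≤ → ≤-trans i≤ l<x) (Good-bounded (suc n) v∈ good)) avoid

weight : ℕ → (ℕ → ℕ) → Word → ℕ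
weight n φ e = if does (good? n e) then φ (n ∸ 1 ∸ lastLetter e) else 0

goodWeight : ℕ → (ℕ → ℕ) → ℕ
goodWeight n φ = sum (map (weight n φ) (invSeqs n))

prefixSums : (ℕ → ℕ) → ℕ → ℕ
prefixSums φ s = sum (applyUpTo φ (suc s))

weight-Good : (n : ℕ) (φ : ℕ → ℕ) (e : Word) → Good n e → weight n φ e ≡ φ (n ∸ 1 ∸ lastLetter e)
weight-Good n φ e good =
  cong (λ b → if b then φ (n ∸ 1 ∸ lastLetter e) else 0) (dec-true (good? n e) good)

weight-¬Good : (n : ℕ) (φ : ℕ → ℕ) (e : Word) → ¬ Good n e → weight n φ e ≡ 0
weight-¬Good n φ e ¬good =
  cong (λ b → if b then φ (n ∸ 1 ∸ lastLetter e) else 0) (dec-false (good? n e) ¬good)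

sum-weight-∷ʳ-Good : (n : ℕ) (φ : ℕ → ℕ) {v : Word} → v ∈ invSeqs (suc n) → Good (suc n) v →
  sum (applyUpTo (λ x → weight (2 + n) φ (v ∷ʳ x)) (2 + n)) ≡ prefixSums φ (n ∸ lastLetter v)
sum-weight-∷ʳ-Good n φ {v} v∈ good = begin
  sum (applyUpTo (λ x → weight (2 + n) φ (v ∷ʳ x)) (2 + n))
    ≡⟨ cong sum (applyUpTo-cong _ _ (2 + n) (λ {x} _ → weight-∷ʳ x)) ⟩
  sum (applyUpTo (λ x → if lastLetter v <ᵇ x then φ (suc n ∸ x) else 0) (2 + n))
    ≡⟨ sum-applyUpTo-above φ (lastLetter v) (suc n) ⟩
  sum (applyUpTo φ (suc n ∸ lastLetter v))
    ≡⟨ cong (sum ∘ applyUpTo φ) (+-∸-assoc 1 l≤n) ⟩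
  prefixSums φ (n ∸ lastLetter v) ∎
  where
  l≤n : lastLetter v ≤ n
  l≤n with invSeqs-∷ʳ⁻ n v∈
  ... | u , x , _ , x<1+n , refl = ≤-pred (subst (_< suc n) (sym (lastLetter-∷ʳ u x)) x<1+n)
  v≢upTo : v ≢ upTo (suc n)
  v≢upTo refl = upTo-¬Good n good
  weight-∷ʳ : (x : ℕ) → weight (2 + n) φ (v ∷ʳ x) ≡ (if lastLetter v <ᵇ x then φ (suc n ∸ x) else 0)
  weight-∷ʳ x with lastLetter v <ᵇ x | <ᵇ-reflects-< (lastLetter v) x
  ... | true  | ofʸ l<x = trans (weight-Good (2 + n) φ (v ∷ʳ x) (Good-∷ʳ (suc n) v∈ good l<x))
                                (cong (λ l → φ (suc n ∸ l)) (lastLetter-∷ʳ v x))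
  ... | false | ofⁿ l≮x = weight-¬Good (2 + n) φ (v ∷ʳ x) (l≮x ∘ proj₂ ∘ Good-∷ʳ⁻ (suc n) v∈ v≢upTo)

sum-weight-∷ʳ-¬Good : (n : ℕ) (φ : ℕ → ℕ) {v : Word} → v ∈ invSeqs n → v ≢ upTo n → ¬ Good n v →
  sum (applyUpTo (λ x → weight (suc n) φ (v ∷ʳ x)) (suc n)) ≡ 0
sum-weight-∷ʳ-¬Good n φ {v} v∈ v≢upTo ¬good = sum-applyUpTo-zero _ (suc n) λ {x} _ →
  weight-¬Good (suc n) φ (v ∷ʳ x) (¬good ∘ proj₁ ∘ Good-∷ʳ⁻ n v∈ v≢upTo)

sum-weight-upTo-∷ʳ : (k : ℕ) (φ : ℕ → ℕ) →
  sum (applyUpTo (λ x → weight (3 + k) φ (upTo (2 + k) ∷ʳ x)) (3 + k)) ≡ φ 1 + φ 2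
sum-weight-upTo-∷ʳ k φ = begin
  sum (applyUpTo w (3 + k))                          ≡⟨ sum-applyUpTo-suc w (2 + k) ⟩
  sum (applyUpTo w (2 + k)) + w (2 + k)              ≡⟨ cong (_+ w (2 + k)) (sum-applyUpTo-suc w (1 + k)) ⟩
  sum (applyUpTo w (1 + k)) + w (1 + k) + w (2 + k)  ≡⟨ cong (λ s → s + w (1 + k) + w (2 + k))
                                                            (sum-applyUpTo-suc w k) ⟩
  sum (applyUpTo w k) + w k + w (1 + k) + w (2 + k)  ≡⟨ cong₂ (λ s t → s + w k + w (1 + k) + t)
                                                             (sum-applyUpTo-zero w k below) top ⟩
  w k + w (1 + k) + 0                                ≡⟨ cong₂ (λ s t → s + t + 0) gap₂ gap₁ ⟩
  φ 2 + φ 1 + 0                                      ≡⟨ trans (+-identityʳ _) (+-comm (φ 2) (φ 1)) ⟩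
  φ 1 + φ 2                                          ∎
  where
  w : ℕ → ℕ
  w x = weight (3 + k) φ (upTo (2 + k) ∷ʳ x)
  below : {x : ℕ} → x < k → w x ≡ 0
  below {x} x<k = weight-¬Good (3 + k) φ (upTo (2 + k) ∷ʳ x)
    (λ good → <⇒≱ x<k (≤-pred (≤-pred (Good-upTo-∷ʳ⁻ good))))
  middle : {x : ℕ} → k ≤ x → x ≤ suc k → w x ≡ φ (2 + k ∸ x)
  middle {x} k≤x x≤1+k =
    trans (weight-Good (3 + k) φ (upTo (2 + k) ∷ʳ x) (Good-upTo-∷ʳ k≤x x≤1+k))
          (cong (λ l → φ (2 + k ∸ l)) (lastLetter-∷ʳ (upTo (2 + k)) x))
  gap₂ : w k ≡ φ 2
  gap₂ = trans (middle ≤-refl (n≤1+n k)) (cong φ (m+n∸n≡m 2 k))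
  gap₁ : w (1 + k) ≡ φ 1
  gap₁ = trans (middle (n≤1+n k) ≤-refl) (cong φ (m+n∸n≡m 1 k))
  top : w (2 + k) ≡ 0
  top = weight-¬Good (3 + k) φ (upTo (2 + k) ∷ʳ (2 + k))
    (subst (¬_ ∘ Good (3 + k)) (sym (upTo-∷ʳ (2 + k))) (upTo-¬Good (2 + k)))

sum-weight-∷ʳ : (k : ℕ) (φ : ℕ → ℕ) {v : Word} → v ∈ invSeqs (2 + k) →
  sum (applyUpTo (λ x → weight (3 + k) φ (v ∷ʳ x)) (3 + k)) ≡
  weight (2 + k) (prefixSums φ) v + staircaseWeight (2 + k) (φ 1 + φ 2) v
sum-weight-∷ʳ k φ {v} v∈ with v ≟ʷ upTo (2 + k)
... | yes refl =
  trans (sum-weight-upTo-∷ʳ k φ)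
        (cong (_+ (φ 1 + φ 2)) (sym (weight-¬Good (2 + k) (prefixSums φ) _ (upTo-¬Good (suc k)))))
... | no v≢upTo with good? (2 + k) v
...   | yes good = trans (sum-weight-∷ʳ-Good (suc k) φ v∈ good)
                         (sym (trans (+-identityʳ _) (weight-Good (2 + k) (prefixSums φ) v good)))
...   | no ¬good = trans (sum-weight-∷ʳ-¬Good (2 + k) φ v∈ v≢upTo ¬good)
                         (sym (trans (+-identityʳ _) (weight-¬Good (2 + k) (prefixSums φ) v ¬good)))

goodWeight-suc : (k : ℕ) (φ : ℕ → ℕ) →
                 goodWeight (3 + k) φ ≡ goodWeight (2 + k) (prefixSums φ) + (φ 1 + φ 2)
goodWeight-suc k φ = begin
  goodWeight (3 + k) φ
    ≡⟨ sum-invSeqs-suc (weight (3 + k) φ) (2 + k) ⟩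
  sum (map (λ v → sum (applyUpTo (λ x → weight (3 + k) φ (v ∷ʳ x)) (3 + k))) (invSeqs (2 + k)))
    ≡⟨ sum-map-cong-∈ (sum-weight-∷ʳ k φ) ⟩
  sum (map (λ v → weight (2 + k) ψ v + staircaseWeight (2 + k) (φ 1 + φ 2) v) (invSeqs (2 + k)))
    ≡⟨ sum-map-+ (weight (2 + k) ψ) (staircaseWeight (2 + k) (φ 1 + φ 2)) (invSeqs (2 + k)) ⟩
  goodWeight (2 + k) ψ + sum (map (staircaseWeight (2 + k) (φ 1 + φ 2)) (invSeqs (2 + k)))
    ≡⟨ cong (goodWeight (2 + k) ψ +_) (sum-staircaseWeight-invSeqs (2 + k) (φ 1 + φ 2)) ⟩
  goodWeight (2 + k) ψ + (φ 1 + φ 2) ∎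
  where
  ψ : ℕ → ℕ
  ψ = prefixSums φ

binomial₂ : (k : ℕ) → (2 + k) C 2 ≡ suc k + (1 + k) C 2
binomial₂ k =
  trans (sym (nCk+nC[k+1]≡[n+1]C[k+1] (suc k) 1)) (cong (_+ (1 + k) C 2) (nC1≡n (suc k)))

binomial₃ : (k : ℕ) → (3 + k) C 3 ≡ (2 + k) C 3 + suc ((1 + k) C 2) + k
binomial₃ k = begin
  (3 + k) C 3                          ≡⟨ nCk+nC[k+1]≡[n+1]C[k+1] (2 + k) 2 ⟨
  (2 + k) C 2 + (2 + k) C 3            ≡⟨ cong (_+ (2 + k) C 3) (binomial₂ k) ⟩
  suc k + (1 + k) C 2 + (2 + k) C 3    ≡⟨ rearrange k ((1 + k) C 2) ((2 + k) C 3) ⟩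
  (2 + k) C 3 + suc ((1 + k) C 2) + k  ∎
  where
  open +-*-Solver
  rearrange : (k c₂ c₃ : ℕ) → suc k + c₂ + c₃ ≡ c₃ + suc c₂ + k
  rearrange = solve 3 (λ k c₂ c₃ → con 1 :+ k :+ c₂ :+ c₃ := c₃ :+ (con 1 :+ c₂) :+ k) refl

goodWeight-formula : (k : ℕ) (φ : ℕ → ℕ) →
  goodWeight (2 + k) φ ≡ ((2 + k) C 3) * φ 0 + suc ((1 + k) C 2) * φ 1 + k * φ 2
goodWeight-formula zero    φ = sym (+-identityʳ (φ 1 + 0))
goodWeight-formula (suc k) φ = begin
  goodWeight (3 + k) φ
    ≡⟨ goodWeight-suc k φ ⟩
  goodWeight (2 + k) ψ + (φ 1 + φ 2)
    ≡⟨ cong (_+ (φ 1 + φ 2)) (goodWeight-formula k ψ) ⟩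
  c₃ * ψ 0 + suc c₂ * ψ 1 + k * ψ 2 + (φ 1 + φ 2)
    ≡⟨ collect c₃ c₂ k (φ 0) (φ 1) (φ 2) ⟩
  (c₃ + suc c₂ + k) * φ 0 + suc (suc k + c₂) * φ 1 + suc k * φ 2
    ≡⟨ cong₂ (λ a b → a * φ 0 + suc b * φ 1 + suc k * φ 2) (binomial₃ k) (binomial₂ k) ⟨
  ((3 + k) C 3) * φ 0 + suc ((2 + k) C 2) * φ 1 + suc k * φ 2 ∎
  where
  open +-*-Solver
  ψ : ℕ → ℕ
  ψ = prefixSums φ
  c₃ c₂ : ℕ
  c₃ = (2 + k) C 3
  c₂ = (1 + k) C 2
  collect : (c₃ c₂ k f₀ f₁ f₂ : ℕ) →
    c₃ * (f₀ + 0) + suc c₂ * (f₀ + (f₁ + 0)) + k * (f₀ + (f₁ + (f₂ + 0))) + (f₁ + f₂) ≡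
    (c₃ + suc c₂ + k) * f₀ + suc (suc k + c₂) * f₁ + suc k * f₂
  collect = solve 6 (λ c₃ c₂ k f₀ f₁ f₂ →
    c₃ :* (f₀ :+ con 0) :+ (con 1 :+ c₂) :* (f₀ :+ (f₁ :+ con 0)) :+
    k :* (f₀ :+ (f₁ :+ (f₂ :+ con 0))) :+ (f₁ :+ f₂) :=
    (c₃ :+ (con 1 :+ c₂) :+ k) :* f₀ :+ (con 1 :+ (con 1 :+ k :+ c₂)) :* f₁ :+ (con 1 :+ k) :* f₂) refl

length-filter-filter : {P Q : A → Set} (P? : Decidable P) (Q? : Decidable Q) (xs : List A) →
  length (filter P? (filter Q? xs)) ≡ sum (map (λ x → if does (Q? x) ∧ does (P? x) then 1 else 0) xs)
length-filter-filter P? Q? []       = refl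
length-filter-filter P? Q? (x ∷ xs) with does (Q? x)
... | false = length-filter-filter P? Q? xs
... | true with does (P? x)
...   | false = length-filter-filter P? Q? xs
...   | true  = cong suc (length-filter-filter P? Q? xs)

does-≟ᵇ-true : (b : Bool) → does (b ≟ᵇ true) ≡ b
does-≟ᵇ-true false = refl
does-≟ᵇ-true true  = refl

length-goodSeqs : (n : ℕ) → length (goodSeqs n) ≡ goodWeight n (λ _ → 1)
length-goodSeqs n =
  trans (length-filter-filter _ _ (invSeqs n)) (cong sum (map-cong pointwise (invSeqs n)))
  where
  pointwise : (e : Word) →
    (if does (layers e ≟ n ∸ 1) ∧ does (avoids e p120 ∧ avoids e p201 ∧ avoids e p1010 ≟ᵇ true)
     then 1 else 0) ≡
    weight n (λ _ → 1) e
  pointwise e = cong (λ b → if does (layers e ≟ n ∸ 1) ∧ b then 1 else 0) (does-≟ᵇ-true _)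

mainTheorem7 : (n : ℕ) → n ≥ 1 → length (goodSeqs n) ≡ (n + 1) C 3
mainTheorem7 (suc zero)    _ = refl
mainTheorem7 (suc (suc k)) _ = begin
  length (goodSeqs (2 + k))                          ≡⟨ length-goodSeqs (2 + k) ⟩
  goodWeight (2 + k) (λ _ → 1)                       ≡⟨ goodWeight-formula k (λ _ → 1) ⟩
  ((2 + k) C 3) * 1 + suc ((1 + k) C 2) * 1 + k * 1  ≡⟨ cong₂ _+_ (cong₂ _+_ (*-identityʳ c₃)
                                                                           (*-identityʳ (suc c₂)))
                                                                (*-identityʳ k) ⟩
  (2 + k) C 3 + suc ((1 + k) C 2) + k                ≡⟨ binomial₃ k ⟨
  (3 + k) C 3                                        ≡⟨ cong (λ m → suc (suc m) C 3) (+-comm 1 k) ⟩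
  (2 + k + 1) C 3                                    ∎
  where
  c₃ c₂ : ℕ
  c₃ = (2 + k) C 3
  c₂ = (1 + k) C 2
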